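{- Let $\mathfrak{X}$ be an association scheme of rank $4$ and diameter $2$ on $n$ vertices whose non-diagonal constituents have degrees $k_1\le k_2\le k_3$, and let $\gamma>0$. If $k_2\geq\gamma k_3$, then every pair of distinct vertices is distinguished by at least $\frac{\gamma(n-1)}{6}$ vertices.
   Context: An association scheme on $V$ is a symmetric coloring $c:V\times V\to\{0,\dots,r-1\}$ ($r$ = rank), color $0$ exactly on the diagonal, with intersection numbers $p^t_{i,j}$ (whenever $c(u,v)=t$, exactly $p^t_{i,j}$ vertices $w$ have $c(u,w)=i$, $c(w,v)=j$). The constituent $X_i$ is the graph with $u\sim v$ iff $c(u,v)=i$; it is $k_i$-regular. The scheme has diameter $2$ if every non-diagonal constituent has diameter at most $2$ and some has diameter exactly $2$. A vertex $x$ distinguishes $u,v$ if $c(x,u)\ne c(x,v)$.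
   Formalization: The parameter γ ranges over the positive rationals. -}

module Defs where

open import Data.Nat using (ℕ; zero; suc)
open import Data.Fin using (Fin; zero; suc)
open import Data.Fin.Properties using () renaming (_≟_ to _≟F_)
open import Data.List using (length; filter)
import Data.List
open import Data.Product using (Σ; _×_; ∃; ∃-syntax)
open import Data.Sum using (_⊎_)
open import Relation.Binary.PropositionalEquality using (_≡_; _≢_)
open import Relation.Nullary using (¬_; _×-dec_; ¬?)
open import Relation.Unary using (Decidable)

Coloring : ℕ → ℕ → Set
Coloring n r = Fin n → Fin n → Fin r

count : ∀ {n} {P : Fin n → Set} → Decidable P → ℕ
count {n} P? = length (filter P? (Data.List.allFin n))

interCount : ∀ {n r} → Coloring n r → Fin n → Fin n → Fin r → Fin r → ℕ
interCount c u v i j = count (λ w → (c u w ≟F i) ×-dec (c w v ≟F j))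

record IsAssocScheme {n r : ℕ} (c : Coloring n (suc r)) : Set where
  field
    symmetric    : ∀ u v → c u v ≡ c v u
    diag→zero    : ∀ u → c u u ≡ zero
    zero→diag    : ∀ u v → c u v ≡ zero → u ≡ v
    surjective   : ∀ i → ∃[ u ] ∃[ v ] c u v ≡ i
    intersection : ∀ t i j → ∃[ p ] (∀ u v → c u v ≡ t → interCount c u v i j ≡ p)

degree : ∀ {n r} → Coloring n r → Fin r → Fin n → ℕ
degree c i u = count (λ w → c u w ≟F i)

DiamAtMost2 : ∀ {n r} → Coloring n r → Fin r → Set
DiamAtMost2 c i = ∀ u v → u ≢ v → c u v ≡ i ⊎ ∃[ w ] (c u w ≡ i × c w v ≡ i)

HasDiameter2 : ∀ {n r} → Coloring n (suc r) → Set
HasDiameter2 c =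
  (∀ i → i ≢ zero → DiamAtMost2 c i) ×
  ∃[ i ] (i ≢ zero × ∃[ u ] ∃[ v ] (u ≢ v × c u v ≢ i))

distinguishers : ∀ {n r} → Coloring n r → Fin n → Fin n → ℕ
distinguishers c u v = count (λ x → ¬? (c x u ≟F c x v))

module Submission where

-- Let D(u,v) be the number of vertices distinguishing u and v. Since the non-distinguishers of
-- u, v are counted by the intersection numbers pᵢᵢ of the colour of (u,v), D depends only on that
-- colour; it also satisfies the triangle inequality. Fix u ≠ v of colour t. As Xₜ has diameter
-- at most 2, D(u,w) ≤ 2 D(u,v) for all w ≠ u. Counting Σ_w D(u,w) by the distinguishing vertex x
-- instead, each x ≠ u has c(x,w) ≠ c(x,u) for at least k₂ vertices w, as colour 2 or 3 differs
-- from c(x,u) ≠ 0. So (n-1) k₂ ≤ 2 (n-1) D(u,v), and n - 1 = k₁ + k₂ + k₃ ≤ 3 k₃ ≤ 3 k₂ / γ.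

open import Defs
open import Algebra.Properties.CommutativeSemigroup using (x∙yz≈y∙xz)
open import Data.Bool using (if_then_else_)
open import Data.Fin using (Fin; zero; suc; punchIn)
open import Data.Fin.Properties using (punchInᵢ≢i) renaming (_≟_ to _≟F_)
open import Data.List using (length; filter; tabulate)
open import Data.Nat using (ℕ; zero; suc; _+_; _*_; _∸_; _≤_; _>_; z≤n; s≤s; z<s; >-nonZero)
open import Data.Nat.Properties
open import Data.Nat.Solver using (module +-*-Solver)
open import Data.Product using (_,_; proj₂)
open import Data.Sum using (_⊎_; inj₁; inj₂)
open import Function using (_∘_; id)
open import Relation.Binary.PropositionalEquality
  using (_≡_; _≢_; refl; sym; trans; cong; cong₂; module ≡-Reasoning)
open import Relation.Nullary using (Dec; yes; no; does; ¬_; ¬?; _×-dec_; contradiction)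
open import Relation.Unary using (Decidable)
open import Relation.Unary.Properties using (U?; ∅?)
open import Algebra.Properties.Semiring.Sum +-*-semiring
  using (sum; sum-syntax; sum-cong-≗; sum-replicate-zero; sum-remove; ∑-distrib-+; ∑-comm)

indicator : ∀ {p} {P : Set p} → Dec P → ℕ
indicator P? = if does P? then 1 else 0

sum-mono-≤ : ∀ {n} {f g : Fin n → ℕ} → (∀ i → f i ≤ g i) → sum f ≤ sum g
sum-mono-≤ {zero}  f≤g = z≤n
sum-mono-≤ {suc n} f≤g = +-mono-≤ (f≤g zero) (sum-mono-≤ (f≤g ∘ suc))

∑-const : ∀ n k → ∑[ i < n ] k ≡ n * k
∑-const zero    k = refl
∑-const (suc n) k = cong (k +_) (∑-const n k)

∑-indicator-≟ : ∀ {r} (x : Fin r) → ∑[ j < r ] indicator (x ≟F j) ≡ 1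
∑-indicator-≟ {suc r} zero    = cong suc (sum-replicate-zero r)
∑-indicator-≟ {suc r} (suc x) = ∑-indicator-≟ x

indicator-mono : ∀ {A B : Set} (A? : Dec A) (B? : Dec B) → (A → B) → indicator A? ≤ indicator B?
indicator-mono (yes a) (yes _) _   = ≤-refl
indicator-mono (yes a) (no ¬b) A→B = contradiction (A→B a) ¬b
indicator-mono (no _)  _       _   = z≤n

indicator-⊆-∪ : ∀ {A B C : Set} (C? : Dec C) (A? : Dec A) (B? : Dec B) →
  (C → A ⊎ B) → indicator C? ≤ indicator A? + indicator B?
indicator-⊆-∪ (no _)  _       _       _   = z≤n
indicator-⊆-∪ (yes _) (yes _) _       _   = s≤s z≤n
indicator-⊆-∪ (yes _) (no _)  (yes _) _   = ≤-refl
indicator-⊆-∪ (yes c) (no ¬a) (no ¬b) C→A⊎B with C→A⊎B c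
... | inj₁ a = contradiction a ¬a
... | inj₂ b = contradiction b ¬b

indicator-complement : ∀ {A : Set} (A? : Dec A) → indicator A? + indicator (¬? A?) ≡ 1
indicator-complement (yes _) = refl
indicator-complement (no _)  = refl

indicator-fibres : ∀ {r} {A : Set} (A? : Dec A) (x : Fin r) →
  indicator A? ≡ ∑[ j < r ] indicator (A? ×-dec (x ≟F j))
indicator-fibres     (yes _) x = sym (∑-indicator-≟ x)
indicator-fibres {r} (no _)  x = sym (sum-replicate-zero r)

count≡∑indicator : ∀ {n} {P : Fin n → Set} (P? : Decidable P) →
  count P? ≡ ∑[ i < n ] indicator (P? i)
count≡∑indicator {n} {P} P? = length-filter-tabulate id
  where
  length-filter-tabulate : ∀ {m} (f : Fin m → Fin n) →
    length (filter P? (tabulate f)) ≡ ∑[ i < m ] indicator (P? (f i))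
  length-filter-tabulate {zero}  f = refl
  length-filter-tabulate {suc m} f with P? (f zero)
  ... | yes _ = cong suc (length-filter-tabulate (f ∘ suc))
  ... | no _  = length-filter-tabulate (f ∘ suc)

count-mono : ∀ {n} {P Q : Fin n → Set} (P? : Decidable P) (Q? : Decidable Q) →
  (∀ i → P i → Q i) → count P? ≤ count Q?
count-mono {n} P? Q? P⊆Q = begin
  count P?                    ≡⟨ count≡∑indicator P? ⟩
  ∑[ i < n ] indicator (P? i) ≤⟨ sum-mono-≤ (λ i → indicator-mono (P? i) (Q? i) (P⊆Q i)) ⟩
  ∑[ i < n ] indicator (Q? i) ≡⟨ count≡∑indicator Q? ⟨
  count Q?                    ∎
  where open ≤-Reasoning

count-cong : ∀ {n} {P Q : Fin n → Set} (P? : Decidable P) (Q? : Decidable Q) →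
  (∀ i → P i → Q i) → (∀ i → Q i → P i) → count P? ≡ count Q?
count-cong P? Q? P⊆Q Q⊆P = ≤-antisym (count-mono P? Q? P⊆Q) (count-mono Q? P? Q⊆P)

count-none : ∀ {n} {P : Fin n → Set} (P? : Decidable P) → (∀ i → ¬ P i) → count P? ≡ 0
count-none {n} P? ¬P = n≤0⇒n≡0 (begin
  count P?                  ≤⟨ count-mono P? ∅? ¬P ⟩
  count (∅? {A = Fin n})    ≡⟨ count≡∑indicator {n} ∅? ⟩
  ∑[ i < n ] 0              ≡⟨ sum-replicate-zero n ⟩
  0                         ∎)
  where open ≤-Reasoning

count-⊆-∪ : ∀ {n} {P Q R : Fin n → Set} (R? : Decidable R) (P? : Decidable P) (Q? : Decidable Q) →
  (∀ i → R i → P i ⊎ Q i) → count R? ≤ count P? + count Q?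
count-⊆-∪ {n} R? P? Q? R⊆P∪Q = begin
  count R?                                          ≡⟨ count≡∑indicator R? ⟩
  ∑[ i < n ] indicator (R? i)                       ≤⟨ sum-mono-≤ (λ i → indicator-⊆-∪ (R? i) (P? i) (Q? i) (R⊆P∪Q i)) ⟩
  ∑[ i < n ] (indicator (P? i) + indicator (Q? i))  ≡⟨ ∑-distrib-+ (indicator ∘ P?) (indicator ∘ Q?) ⟩
  ∑[ i < n ] indicator (P? i) + ∑[ i < n ] indicator (Q? i)
    ≡⟨ cong₂ _+_ (count≡∑indicator P?) (count≡∑indicator Q?) ⟨
  count P? + count Q?                               ∎
  where open ≤-Reasoning

count-complement : ∀ {n} {P : Fin n → Set} (P? : Decidable P) → count P? + count (¬? ∘ P?) ≡ n
count-complement {n} P? = begin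
  count P? + count (¬? ∘ P?)
    ≡⟨ cong₂ _+_ (count≡∑indicator P?) (count≡∑indicator (¬? ∘ P?)) ⟩
  ∑[ i < n ] indicator (P? i) + ∑[ i < n ] indicator (¬? (P? i))
    ≡⟨ ∑-distrib-+ (indicator ∘ P?) (indicator ∘ ¬? ∘ P?) ⟨
  ∑[ i < n ] (indicator (P? i) + indicator (¬? (P? i)))
    ≡⟨ sum-cong-≗ (indicator-complement ∘ P?) ⟩
  ∑[ i < n ] 1  ≡⟨ ∑-const n 1 ⟩
  n * 1         ≡⟨ *-identityʳ n ⟩
  n             ∎
  where open ≡-Reasoning

count-fibres : ∀ {n r} {P : Fin n → Set} (P? : Decidable P) (g : Fin n → Fin r) →
  count P? ≡ ∑[ j < r ] count (λ i → P? i ×-dec (g i ≟F j))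
count-fibres {n} {r} P? g = begin
  count P?                                                ≡⟨ count≡∑indicator P? ⟩
  ∑[ i < n ] indicator (P? i)                             ≡⟨ sum-cong-≗ (λ i → indicator-fibres (P? i) (g i)) ⟩
  ∑[ i < n ] ∑[ j < r ] indicator (P? i ×-dec (g i ≟F j)) ≡⟨ ∑-comm (λ i j → indicator (P? i ×-dec (g i ≟F j))) ⟩
  ∑[ j < r ] ∑[ i < n ] indicator (P? i ×-dec (g i ≟F j))
    ≡⟨ sum-cong-≗ (λ j → count≡∑indicator (λ i → P? i ×-dec (g i ≟F j))) ⟨
  ∑[ j < r ] count (λ i → P? i ×-dec (g i ≟F j))          ∎
  where open ≡-Reasoning

∑-count-comm : ∀ {m n} {R : Fin m → Fin n → Set} (R? : ∀ i j → Dec (R i j)) →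
  ∑[ i < m ] count (R? i) ≡ ∑[ j < n ] count (λ i → R? i j)
∑-count-comm {m} {n} R? = begin
  ∑[ i < m ] count (R? i)                    ≡⟨ sum-cong-≗ (λ i → count≡∑indicator (R? i)) ⟩
  ∑[ i < m ] ∑[ j < n ] indicator (R? i j)   ≡⟨ ∑-comm (λ i j → indicator (R? i j)) ⟩
  ∑[ j < n ] ∑[ i < m ] indicator (R? i j)   ≡⟨ sum-cong-≗ (λ j → count≡∑indicator (λ i → R? i j)) ⟨
  ∑[ j < n ] count (λ i → R? i j)            ∎
  where open ≡-Reasoning

∑-≤-except : ∀ {n k} (f : Fin n → ℕ) (u : Fin n) →
  f u ≡ 0 → (∀ w → w ≢ u → f w ≤ k) → ∑[ w < n ] f w ≤ (n ∸ 1) * k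
∑-≤-except {suc n} {k} f u fu≡0 f≤k = begin
  sum f                            ≡⟨ sum-remove {i = u} f ⟩
  f u + ∑[ j < n ] f (punchIn u j) ≡⟨ cong (_+ ∑[ j < n ] f (punchIn u j)) fu≡0 ⟩
  ∑[ j < n ] f (punchIn u j)       ≤⟨ sum-mono-≤ (λ j → f≤k (punchIn u j) (punchInᵢ≢i u j)) ⟩
  ∑[ j < n ] k                     ≡⟨ ∑-const n k ⟩
  n * k                            ∎
  where open ≤-Reasoning

∑-≥-except : ∀ {n k} (f : Fin n → ℕ) (u : Fin n) →
  (∀ w → w ≢ u → k ≤ f w) → (n ∸ 1) * k ≤ ∑[ w < n ] f w
∑-≥-except {suc n} {k} f u k≤f = begin
  n * k                            ≡⟨ ∑-const n k ⟨
  ∑[ j < n ] k                     ≤⟨ sum-mono-≤ (λ j → k≤f (punchIn u j) (punchInᵢ≢i u j)) ⟩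
  ∑[ j < n ] f (punchIn u j)       ≤⟨ m≤n+m _ (f u) ⟩
  f u + ∑[ j < n ] f (punchIn u j) ≡⟨ sum-remove {i = u} f ⟨
  sum f                            ∎
  where open ≤-Reasoning

distinct⇒n∸1>0 : ∀ {n} {u v : Fin n} → u ≢ v → n ∸ 1 > 0
distinct⇒n∸1>0 {suc zero}    {zero} {zero} u≢v = contradiction refl u≢v
distinct⇒n∸1>0 {suc (suc n)} _                  = z<s

module _ {n r : ℕ} (c : Coloring n r) where

  distinguishers-self : ∀ u → distinguishers c u u ≡ 0
  distinguishers-self u = count-none (λ x → ¬? (c x u ≟F c x u)) (λ x c≢c → c≢c refl)

  distinguishers-triangle : ∀ u m w →
    distinguishers c u w ≤ distinguishers c u m + distinguishers c m w
  distinguishers-triangle u m w =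
    count-⊆-∪ _ (λ x → ¬? (c x u ≟F c x m)) (λ x → ¬? (c x m ≟F c x w)) separates
    where
    separates : ∀ x → c x u ≢ c x w → c x u ≢ c x m ⊎ c x m ≢ c x w
    separates x cu≢cw with c x u ≟F c x m
    ... | yes cu≡cm = inj₂ (λ cm≡cw → cu≢cw (trans cu≡cm cm≡cw))
    ... | no cu≢cm  = inj₁ cu≢cm

  ∑-distinguishers : ∀ u →
    ∑[ w < n ] distinguishers c u w ≡ ∑[ x < n ] count (λ w → ¬? (c x u ≟F c x w))
  ∑-distinguishers u = ∑-count-comm (λ w x → ¬? (c x u ≟F c x w))

  ∑-degree : ∀ u → ∑[ i < r ] degree c i u ≡ n
  ∑-degree u = begin
    ∑[ i < r ] degree c i u                               ≡⟨ sum-cong-≗ in-fibre ⟩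
    ∑[ i < r ] count (λ w → U? w ×-dec (c u w ≟F i))      ≡⟨ count-fibres U? (c u) ⟨
    count (U? {A = Fin n})                                ≡⟨ count≡∑indicator {n} U? ⟩
    ∑[ w < n ] 1                                          ≡⟨ ∑-const n 1 ⟩
    n * 1                                                 ≡⟨ *-identityʳ n ⟩
    n                                                     ∎
    where
    open ≡-Reasoning
    in-fibre : ∀ i → degree c i u ≡ count (λ w → U? w ×-dec (c u w ≟F i))
    in-fibre i = count-cong _ (λ w → U? w ×-dec (c u w ≟F i)) (λ w e → _ , e) (λ w → proj₂)

  degree-≤-avoiding : ∀ {i j} x → i ≢ j → degree c i x ≤ count (λ w → ¬? (j ≟F c x w))
  degree-≤-avoiding {i} {j} x i≢j = count-mono (λ w → c x w ≟F i) (λ w → ¬? (j ≟F c x w))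
    (λ w cxw≡i j≡cxw → i≢j (trans (sym cxw≡i) (sym j≡cxw)))

module _ {n r : ℕ} {c : Coloring n (suc r)} (scheme : IsAssocScheme c) where
  open IsAssocScheme scheme

  degree-zero : ∀ u → degree c zero u ≡ 1
  degree-zero u = begin
    degree c zero u                 ≡⟨ count-cong _ (u ≟F_) (zero→diag u) (λ { w refl → diag→zero u }) ⟩
    count (u ≟F_)                   ≡⟨ count≡∑indicator (u ≟F_) ⟩
    ∑[ w < n ] indicator (u ≟F w)   ≡⟨ ∑-indicator-≟ u ⟩
    1                               ∎
    where open ≡-Reasoning

  n∸1≡∑-degrees : ∀ u → n ∸ 1 ≡ ∑[ i < r ] degree c (suc i) u
  n∸1≡∑-degrees u = cong (_∸ 1) (begin
    n                                                ≡⟨ ∑-degree c u ⟨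
    degree c zero u + ∑[ i < r ] degree c (suc i) u  ≡⟨ cong (_+ ∑[ i < r ] degree c (suc i) u) (degree-zero u) ⟩
    suc (∑[ i < r ] degree c (suc i) u)              ∎)
    where open ≡-Reasoning

  distinguishers+∑interCount : ∀ u v → distinguishers c u v + ∑[ i < suc r ] interCount c u v i i ≡ n
  distinguishers+∑interCount u v = begin
    distinguishers c u v + ∑[ i < suc r ] interCount c u v i i
      ≡⟨ cong (distinguishers c u v +_) (sum-cong-≗ agree-in-fibre) ⟨
    distinguishers c u v + ∑[ i < suc r ] count (λ x → agree? x ×-dec (c u x ≟F i))
      ≡⟨ cong (distinguishers c u v +_) (count-fibres agree? (c u)) ⟨
    distinguishers c u v + count agree?
      ≡⟨ +-comm (distinguishers c u v) (count agree?) ⟩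
    count agree? + distinguishers c u v
      ≡⟨ count-complement agree? ⟩
    n ∎
    where
    open ≡-Reasoning
    agree? : ∀ x → Dec (c x u ≡ c x v)
    agree? x = c x u ≟F c x v
    agree-in-fibre : ∀ i → count (λ x → agree? x ×-dec (c u x ≟F i)) ≡ interCount c u v i i
    agree-in-fibre i = count-cong (λ x → agree? x ×-dec (c u x ≟F i)) (λ w → (c u w ≟F i) ×-dec (c w v ≟F i))
      (λ x (cxu≡cxv , cux≡i) → cux≡i , trans (sym cxu≡cxv) (trans (symmetric x u) cux≡i))
      (λ x (cux≡i , cxv≡i) → trans (symmetric x u) (trans cux≡i (sym cxv≡i)) , cux≡i)

  distinguishers-invariant : ∀ u v x y → c u v ≡ c x y → distinguishers c u v ≡ distinguishers c x y
  distinguishers-invariant u v x y cuv≡cxy =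
    +-cancelʳ-≡ (∑[ i < suc r ] interCount c x y i i) _ _ (begin
      distinguishers c u v + ∑[ i < suc r ] interCount c x y i i
        ≡⟨ cong (distinguishers c u v +_) (sum-cong-≗ same-intersection-numbers) ⟨
      distinguishers c u v + ∑[ i < suc r ] interCount c u v i i
        ≡⟨ distinguishers+∑interCount u v ⟩
      n
        ≡⟨ distinguishers+∑interCount x y ⟨
      distinguishers c x y + ∑[ i < suc r ] interCount c x y i i ∎)
    where
    open ≡-Reasoning
    same-intersection-numbers : ∀ i → interCount c u v i i ≡ interCount c x y i i
    same-intersection-numbers i with intersection (c x y) i i
    ... | p , counts-p = trans (counts-p u v cuv≡cxy) (sym (counts-p x y refl))

  distinguishers-≤-diameter : ∀ u v → DiamAtMost2 c (c u v) →
    ∀ w → w ≢ u → distinguishers c u w ≤ 2 * distinguishers c u v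
  distinguishers-≤-diameter u v diam w w≢u with diam u w (w≢u ∘ sym)
  ... | inj₁ cuw≡cuv = begin
    distinguishers c u w                           ≡⟨ distinguishers-invariant u w u v cuw≡cuv ⟩
    distinguishers c u v                           ≤⟨ m≤m+n _ _ ⟩
    2 * distinguishers c u v                       ∎
    where open ≤-Reasoning
  ... | inj₂ (m , cum≡cuv , cmw≡cuv) = begin
    distinguishers c u w                           ≤⟨ distinguishers-triangle c u m w ⟩
    distinguishers c u m + distinguishers c m w    ≡⟨ cong₂ _+_ (distinguishers-invariant u m u v cum≡cuv)
                                                              (distinguishers-invariant m w u v cmw≡cuv) ⟩
    distinguishers c u v + distinguishers c u v    ≡⟨ cong (distinguishers c u v +_) (+-identityʳ _) ⟨
    2 * distinguishers c u v                       ∎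
    where open ≤-Reasoning

module _ {n : ℕ} {c : Coloring n 4} {k₂ k₃ : ℕ}
         (deg₂ : ∀ u → degree c (suc (suc zero)) u ≡ k₂)
         (deg₃ : ∀ u → degree c (suc (suc (suc zero))) u ≡ k₃)
         (k₂≤k₃ : k₂ ≤ k₃) where

  k₂≤count-other-colours : ∀ x j → j ≢ zero → k₂ ≤ count (λ w → ¬? (j ≟F c x w))
  k₂≤count-other-colours x zero                   j≢0 = contradiction refl j≢0
  k₂≤count-other-colours x (suc zero)             _   =
    ≤-trans (≤-reflexive (sym (deg₂ x))) (degree-≤-avoiding c x (λ ()))
  k₂≤count-other-colours x (suc (suc zero))       _   =
    ≤-trans k₂≤k₃ (≤-trans (≤-reflexive (sym (deg₃ x))) (degree-≤-avoiding c x (λ ())))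
  k₂≤count-other-colours x (suc (suc (suc zero))) _   =
    ≤-trans (≤-reflexive (sym (deg₂ x))) (degree-≤-avoiding c x (λ ()))

  k₂≤2*distinguishers : IsAssocScheme c → HasDiameter2 c →
    ∀ u v → u ≢ v → k₂ ≤ 2 * distinguishers c u v
  k₂≤2*distinguishers scheme (diam , _) u v u≢v =
    *-cancelˡ-≤ (n ∸ 1) {{>-nonZero (distinct⇒n∸1>0 u≢v)}} (begin
      (n ∸ 1) * k₂
        ≤⟨ ∑-≥-except _ u (λ x x≢u → k₂≤count-other-colours x (c x u) (x≢u ∘ zero→diag x u)) ⟩
      ∑[ x < n ] count (λ w → ¬? (c x u ≟F c x w))
        ≡⟨ ∑-distinguishers c u ⟨
      ∑[ w < n ] distinguishers c u w
        ≤⟨ ∑-≤-except _ u (distinguishers-self c u)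
             (distinguishers-≤-diameter scheme u v (diam (c u v) (u≢v ∘ zero→diag u v))) ⟩
      (n ∸ 1) * (2 * distinguishers c u v) ∎)
    where
    open ≤-Reasoning
    open IsAssocScheme scheme

lemma4p6 : (n : ℕ) (c : Coloring n 4) → IsAssocScheme c → HasDiameter2 c →
    (k₁ k₂ k₃ : ℕ) →
    (∀ u → degree c (suc zero) u ≡ k₁) →
    (∀ u → degree c (suc (suc zero)) u ≡ k₂) →
    (∀ u → degree c (suc (suc (suc zero))) u ≡ k₃) →
    k₁ ≤ k₂ → k₂ ≤ k₃ →
    -- γ = a / b with a, b positive naturals
    (a b : ℕ) → 1 ≤ a → 1 ≤ b →
    a * k₃ ≤ b * k₂ →
    ∀ u v → u ≢ v → a * (n ∸ 1) ≤ 6 * b * distinguishers c u v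
lemma4p6 n c scheme diameter k₁ k₂ k₃ deg₁ deg₂ deg₃ k₁≤k₂ k₂≤k₃ a b _ _ ak₃≤bk₂ u v u≢v = begin
  a * (n ∸ 1)                 ≡⟨ cong (a *_) n∸1≡k₁+k₂+k₃ ⟩
  a * (k₁ + (k₂ + (k₃ + 0)))  ≤⟨ *-monoʳ-≤ a (+-mono-≤ (≤-trans k₁≤k₂ k₂≤k₃) (+-monoˡ-≤ (k₃ + 0) k₂≤k₃)) ⟩
  a * (3 * k₃)                ≡⟨ x∙yz≈y∙xz *-commutativeSemigroup a 3 k₃ ⟩
  3 * (a * k₃)                ≤⟨ *-monoʳ-≤ 3 ak₃≤bk₂ ⟩
  3 * (b * k₂)                ≤⟨ *-monoʳ-≤ 3 (*-monoʳ-≤ b k₂≤2D) ⟩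
  3 * (b * (2 * D))           ≡⟨ solve 2 (λ b D → con 3 :* (b :* (con 2 :* D)) := con 6 :* b :* D) refl b D ⟩
  6 * b * D                   ∎
  where
  open ≤-Reasoning
  open +-*-Solver
  D : ℕ
  D = distinguishers c u v
  k₂≤2D : k₂ ≤ 2 * D
  k₂≤2D = k₂≤2*distinguishers deg₂ deg₃ k₂≤k₃ scheme diameter u v u≢v
  n∸1≡k₁+k₂+k₃ : n ∸ 1 ≡ k₁ + (k₂ + (k₃ + 0))
  n∸1≡k₁+k₂+k₃ = trans (n∸1≡∑-degrees scheme u)
    (cong₂ _+_ (deg₁ u) (cong₂ _+_ (deg₂ u) (cong (_+ 0) (deg₃ u))))
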